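{- For any positive integer $v\equiv 1\pmod{24}$, there exists a $(v,3,1)$-PDF.
   Context: For a positive integer $v$, elements of $\mathbb{Z}_v$ are identified with representatives in $\{0,\dots,v-1\}$. A $(v,k,\lambda)$-CDF is a collection $\mathcal F$ of $k$-subsets of $\mathbb{Z}_v$ such that the multiset $\bigcup_{F\in\mathcal F}\{x-y \pmod v : x,y\in F,\ x\neq y\}$ contains every nonzero element of $\mathbb{Z}_v$ exactly $\lambda$ times. A positive difference of $F$ is $x-y\pmod v$ for $x,y\in F$ with $x\bmod v>y\bmod v$. For odd $v$, a $(v,k,\lambda)$-PDF is a $(v,k,\lambda)$-CDF whose multiset of positive differences covers each element of $\{1,\dots,(v-1)/2\}$ exactly $\lambda$ times. -}

module Defs where

open import Data.Nat using (ℕ; _+_; _*_; _∸_; _≤_; _<_; _≤ᵇ_; _<ᵇ_; _≡ᵇ_)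
open import Data.Nat.DivMod using (_/_)
open import Data.Bool using (if_then_else_)
open import Data.List using (List; []; _∷_; [_]; concatMap; length; filter)
open import Data.List.Relation.Unary.All using (All)
open import Data.List.Relation.Unary.Unique.Propositional using (Unique)
open import Data.Nat.Properties using (_≟_)
open import Data.Product using (Σ; _×_)
open import Relation.Binary.PropositionalEquality using (_≡_)

-- Elements of ℤ_v are represented by naturals in {0,…,v-1}.
-- A k-subset of ℤ_v: a duplicate-free list of length k of naturals < v.
IsKSubset : (v k : ℕ) → List ℕ → Set
IsKSubset v k F = All (_< v) F × Unique F × length F ≡ k

modSub : ℕ → ℕ → ℕ → ℕ
modSub v x y = if y ≤ᵇ x then x ∸ y else (v + x) ∸ y

differences : ℕ → List ℕ → List ℕ
differences v F =
  concatMap (λ x → concatMap (λ y → if x ≡ᵇ y then [] else [ modSub v x y ]) F) F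

positiveDifferences : List ℕ → List ℕ
positiveDifferences F =
  concatMap (λ x → concatMap (λ y → if y <ᵇ x then [ x ∸ y ] else []) F) F

allDifferences : ℕ → List (List ℕ) → List ℕ
allDifferences v 𝓕 = concatMap (differences v) 𝓕

allPositiveDifferences : List (List ℕ) → List ℕ
allPositiveDifferences 𝓕 = concatMap positiveDifferences 𝓕

mult : ℕ → List ℕ → ℕ
mult d xs = length (filter (d ≟_) xs)

IsCDF : (v k λ' : ℕ) → List (List ℕ) → Set
IsCDF v k λ' 𝓕 =
  All (IsKSubset v k) 𝓕 ×
  (∀ d → 1 ≤ d → d < v → mult d (allDifferences v 𝓕) ≡ λ')

IsPDF : (v k λ' : ℕ) → List (List ℕ) → Set
IsPDF v k λ' 𝓕 =
  IsCDF v k λ' 𝓕 ×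
  (∀ d → 1 ≤ d → d ≤ (v ∸ 1) / 2 → mult d (allPositiveDifferences 𝓕) ≡ λ')

{-# OPTIONS --safe #-}
module Submission where

open import Defs
open import Data.Nat using (ℕ; _<_; _%_)
open import Data.List using (List)
open import Data.Product using (Σ)
open import Relation.Binary.PropositionalEquality using (_≡_)

open import Data.Bool using (true; false)
open import Data.Empty using (⊥-elim)
open import Data.List using ([]; _∷_; [_]; _++_; _∷ʳ_; map; concatMap; length)
open import Data.List.Properties using (filter-accept; filter-reject; map-++; concatMap-++)
open import Data.List.Relation.Binary.Permutation.Propositional
  using (_↭_; ↭-refl; ↭-prep; ↭-sym; ↭-trans; ↭-reflexive; module PermutationReasoning)
open import Data.List.Relation.Binary.Permutation.Propositional.Properties
  using (++⁺; ++⁺ˡ; ++⁺ʳ; shift; ∷↭∷ʳ; map⁺; filter-↭; ↭-length; All-resp-↭; ++-commutativeMonoid)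
open import Data.List.Relation.Unary.All using (All; []; _∷_)
import Data.List.Relation.Unary.All as All
import Data.List.Relation.Unary.All.Properties as All
open import Data.List.Relation.Unary.AllPairs using ([]; _∷_)
open import Data.Nat
open import Data.Nat.DivMod using (_/_; m*n/n≡m; m≡m%n+[m/n]*n)
open import Data.Nat.ListAction using (sum)
open import Data.Nat.Properties
open import Data.Nat.Tactic.RingSolver using (solve-∀; solve)
open import Data.List.Sort.InsertionSort.Properties ≤-decTotalOrder using (sort-↭)
open import Data.Product using (_×_; _,_; proj₂)
import Data.Product as Product
open import Function using (_∘_)
open import Relation.Binary.PropositionalEquality
  using (_≢_; refl; sym; trans; cong; cong₂; subst; module ≡-Reasoning)
open import Relation.Nullary using (yes; no)
open import Relation.Nullary.Decidable using (proof)
open import Relation.Nullary.Reflects using (ofʸ; ofⁿ; det)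
import Algebra.Solver.CommutativeMonoid (++-commutativeMonoid {A = ℕ}) as ↭-Solver
open ↭-Solver using (_⊕_; _⊜_; id)

-- A base block {0, x, x + z} with x, z > 0 has positive differences x, z and x + z, and its
-- remaining differences are their negatives modulo v.  So if the triples {x, z, x + z} partition
-- {1, …, N}, the base blocks form a (2N + 1, 3, 1)-PDF, and for v = 24q + 1 it suffices to
-- partition {1, …, 12q} into such triples.  For q ≥ 2 the partition consists of three blocks of
-- pairs (x, z) in which x steps up by 2 while z steps down by 1, so that the x's, the z's and the
-- sums x + z each sweep an interval or a progression of step 2, plus four single triples; the
-- resulting 21 pieces fit together into {1, …, 12q}.

progression : ℕ → ℕ → ℕ → List ℕ
progression d a zero    = []
progression d a (suc n) = a ∷ progression d (d + a) n

range : ℕ → ℕ → List ℕ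
range = progression 1

progression-++ : ∀ d a m n → progression d a (m + n) ≡ progression d a m ++ progression d (m * d + a) n
progression-++ d a zero    n = refl
progression-++ d a (suc m) n = cong (a ∷_) (begin
  progression d (d + a) (m + n)                                   ≡⟨ progression-++ d (d + a) m n ⟩
  progression d (d + a) m ++ progression d (m * d + (d + a)) n    ≡⟨ cong (λ b → progression d (d + a) m ++ progression d b n) (regroup d a m) ⟩
  progression d (d + a) m ++ progression d (suc m * d + a) n      ∎)
  where
  open ≡-Reasoning
  regroup : ∀ d a m → m * d + (d + a) ≡ (d + m * d) + a
  regroup = solve-∀

range-++ : ∀ a m n → range a (m + n) ≡ range a m ++ range (a + m) n
range-++ a m n = trans (progression-++ 1 a m n) (cong (λ b → range a m ++ range b n) (begin
  m * 1 + a   ≡⟨ cong (_+ a) (*-identityʳ m) ⟩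
  m + a       ≡⟨ +-comm m a ⟩
  a + m       ∎))
  where open ≡-Reasoning

range-∷ʳ : ∀ a n → range a (suc n) ≡ range a n ∷ʳ (n + a)
range-∷ʳ a n = begin
  range a (suc n)              ≡⟨ cong (range a) (+-comm 1 n) ⟩
  range a (n + 1)              ≡⟨ progression-++ 1 a n 1 ⟩
  range a n ++ [ n * 1 + a ]   ≡⟨ cong (λ b → range a n ++ [ b + a ]) (*-identityʳ n) ⟩
  range a n ∷ʳ (n + a)         ∎
  where open ≡-Reasoning

range-↭-interleaved : ∀ a n → range a (n + n) ↭ progression 2 a n ++ progression 2 (suc a) n
range-↭-interleaved a zero    = ↭-refl
range-↭-interleaved a (suc n) rewrite +-suc n n = ↭-prep a (begin
  suc a ∷ range (2 + a) (n + n)                                ↭⟨ ↭-prep (suc a) (range-↭-interleaved (2 + a) n) ⟩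
  suc a ∷ progression 2 (2 + a) n ++ progression 2 (3 + a) n   ↭⟨ shift (suc a) (progression 2 (2 + a) n) _ ⟨
  progression 2 (2 + a) n ++ progression 2 (suc a) (suc n)     ∎)
  where open PermutationReasoning

map-∸-range : ∀ {b c} a n → a + n + b ≡ c → map (c ∸_) (range a n) ↭ range (suc b) n
map-∸-range         a zero    _    = ↭-refl
map-∸-range {b} {c} a (suc n) refl = begin
  c ∸ a ∷ map (c ∸_) (range (suc a) n)      ≡⟨ cong (_∷ map (c ∸_) (range (suc a) n)) c∸a≡1+n+b ⟩
  suc n + b ∷ map (c ∸_) (range (suc a) n)  ↭⟨ ↭-prep (suc n + b) (map-∸-range (suc a) n (cong (_+ b) (sym (+-suc a n)))) ⟩
  suc n + b ∷ range (suc b) n               ↭⟨ ∷↭∷ʳ (suc n + b) (range (suc b) n) ⟩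
  range (suc b) n ∷ʳ (suc n + b)            ≡⟨ cong (range (suc b) n ∷ʳ_) (+-suc n b) ⟨
  range (suc b) n ∷ʳ (n + suc b)            ≡⟨ range-∷ʳ (suc b) n ⟨
  range (suc b) (suc n)                     ∎
  where
  open PermutationReasoning
  c∸a≡1+n+b : c ∸ a ≡ suc n + b
  c∸a≡1+n+b = trans (cong (_∸ a) (+-assoc a (suc n) b)) (m+n∸m≡n a (suc n + b))

All-range : ∀ {P : ℕ → Set} a n → (∀ {i} → a ≤ i → i < a + n → P i) → All P (range a n)
All-range         a zero    P-in = []
All-range {P = P} a (suc n) P-in = P-in ≤-refl (m<m+n a z<s) ∷ All-range (suc a) n P-in′
  where
  P-in′ : ∀ {i} → suc a ≤ i → i < suc a + n → P i
  P-in′ {i} a<i i<1+a+n = P-in (<⇒≤ a<i) (subst (i <_) (sym (+-suc a n)) i<1+a+n)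

runs : ℕ → List (ℕ × ℕ) → List ℕ
runs d = concatMap (λ (a , m) → progression d a m)

totalLength : List (ℕ × ℕ) → ℕ
totalLength = sum ∘ map proj₂

Consecutive : ℕ → ℕ → List (ℕ × ℕ) → ℕ → Set
Consecutive d a []             c = a ≡ c
Consecutive d a ((b , m) ∷ rs) c = a ≡ b × Consecutive d (m * d + b) rs c

runs-consecutive : ∀ {d a c} rs → Consecutive d a rs c → runs d rs ≡ progression d a (totalLength rs)
runs-consecutive     []             _             = refl
runs-consecutive {d} ((a , m) ∷ rs) (refl , rest) =
  trans (cong (progression d a m ++_) (runs-consecutive rs rest)) (sym (progression-++ d a m (totalLength rs)))

consecutive-end : ∀ {d a c} rs → Consecutive d a rs c → totalLength rs * d + a ≡ c
consecutive-end     []             a≡c           = a≡c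
consecutive-end {d} ((a , m) ∷ rs) (refl , rest) =
  trans (regroup m (totalLength rs) d a) (consecutive-end rs rest)
  where
  regroup : ∀ m l d a → (m + l) * d + a ≡ l * d + (m * d + a)
  regroup = solve-∀

runs-tile : ∀ {d a} .{{_ : NonZero d}} n rs → Consecutive d a rs (n * d + a) → runs d rs ≡ progression d a n
runs-tile {d} {a} n rs consecutive = trans (runs-consecutive rs consecutive)
  (cong (progression d a) (*-cancelʳ-≡ _ n d (+-cancelʳ-≡ a _ _ (consecutive-end rs consecutive))))

mult-↭ : ∀ d {xs ys} → xs ↭ ys → mult d xs ≡ mult d ys
mult-↭ d = ↭-length ∘ filter-↭ (d ≟_)

mult-∷-≡ : ∀ d xs → mult d (d ∷ xs) ≡ suc (mult d xs)
mult-∷-≡ d xs = cong length (filter-accept (d ≟_) refl)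

mult-∷-≢ : ∀ {d x} xs → d ≢ x → mult d (x ∷ xs) ≡ mult d xs
mult-∷-≢ xs d≢x = cong length (filter-reject (_ ≟_) d≢x)

mult-range-≡0 : ∀ {d a} n → d < a → mult d (range a n) ≡ 0
mult-range-≡0 zero    d<a = refl
mult-range-≡0 (suc n) d<a = trans (mult-∷-≢ _ (<⇒≢ d<a)) (mult-range-≡0 n (m<n⇒m<1+n d<a))

mult-range-≡1 : ∀ {d a} n → a ≤ d → d < a + n → mult d (range a n) ≡ 1
mult-range-≡1 {d} {a} zero a≤d d<a+0 = ⊥-elim (<⇒≱ d<a+0 (subst (_≤ d) (sym (+-identityʳ a)) a≤d))
mult-range-≡1 {d} {a} (suc n) a≤d d<a+1+n with d ≟ a
... | yes refl = trans (mult-∷-≡ d _) (cong suc (mult-range-≡0 n ≤-refl))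
... | no d≢a   = trans (mult-∷-≢ _ d≢a)
  (mult-range-≡1 n (≤∧≢⇒< a≤d (d≢a ∘ sym)) (subst (d <_) (+-suc a n) d<a+1+n))

≡ᵇ-refl : ∀ n → (n ≡ᵇ n) ≡ true
≡ᵇ-refl zero    = refl
≡ᵇ-refl (suc n) = ≡ᵇ-refl n

≢⇒≡ᵇ≡false : ∀ {m n} → m ≢ n → (m ≡ᵇ n) ≡ false
≢⇒≡ᵇ≡false m≢n = det (proof (_ ≟ _)) (ofⁿ m≢n)

<⇒<ᵇ≡true : ∀ {m n} → m < n → (m <ᵇ n) ≡ true
<⇒<ᵇ≡true m<n = det (<ᵇ-reflects-< _ _) (ofʸ m<n)

≥⇒<ᵇ≡false : ∀ {m n} → n ≤ m → (m <ᵇ n) ≡ false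
≥⇒<ᵇ≡false n≤m = det (<ᵇ-reflects-< _ _) (ofⁿ (≤⇒≯ n≤m))

sumTriple : ℕ × ℕ → List ℕ
sumTriple (x , z) = x ∷ x + z ∷ z ∷ []

sumTriples : List (ℕ × ℕ) → List ℕ
sumTriples = concatMap sumTriple

baseBlock : ℕ × ℕ → List ℕ
baseBlock (x , z) = 0 ∷ x ∷ x + z ∷ []

baseBlock-isKSubset : ∀ {v x z} → 0 < x → 0 < z → x + z < v → IsKSubset v 3 (baseBlock (x , z))
baseBlock-isKSubset {x = x} {z} 0<x 0<z x+z<v =
  (<-trans 0<x+z x+z<v ∷ ≤-<-trans (m≤m+n x z) x+z<v ∷ x+z<v ∷ []) ,
  ((<⇒≢ 0<x ∷ <⇒≢ 0<x+z ∷ []) ∷ (<⇒≢ (m<m+n x 0<z) ∷ []) ∷ [] ∷ []) ,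
  refl
  where
  0<x+z : 0 < x + z
  0<x+z = <-≤-trans 0<x (m≤m+n x z)

positiveDifferences-baseBlock : ∀ {x z} → 0 < x → 0 < z →
  positiveDifferences (baseBlock (x , z)) ≡ sumTriple (x , z)
positiveDifferences-baseBlock {x} {z} 0<x 0<z
  rewrite <⇒<ᵇ≡true 0<x | ≥⇒<ᵇ≡false (≤-refl {x}) | ≥⇒<ᵇ≡false (m≤m+n x z)
        | <⇒<ᵇ≡true (<-≤-trans 0<x (m≤m+n x z)) | <⇒<ᵇ≡true (m<m+n x 0<z) | ≥⇒<ᵇ≡false (≤-refl {x + z})
        | m+n∸m≡n x z
  = refl

differences-baseBlock : ∀ v {x z} → 0 < x → 0 < z →
  differences v (baseBlock (x , z)) ↭ sumTriple (x , z) ++ map (v ∸_) (sumTriple (x , z))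
differences-baseBlock v {suc x} {suc z} _ _ = ↭-trans (↭-reflexive evaluate)
  (↭-Solver.solve 6 (λ x y z x̄ ȳ z̄ → x̄ ⊕ ȳ ⊕ x ⊕ z̄ ⊕ y ⊕ z ⊜ (x ⊕ y ⊕ z) ⊕ (x̄ ⊕ ȳ ⊕ z̄)) ↭-refl
    [ suc x ] [ suc x + suc z ] [ suc z ] [ v ∸ suc x ] [ v ∸ (suc x + suc z) ] [ v ∸ suc z ])
  where
  x<x+1+z : x < x + suc z
  x<x+1+z = m<m+n x z<s

  evaluate : differences v (baseBlock (suc x , suc z)) ≡
             v ∸ suc x ∷ v ∸ (suc x + suc z) ∷ suc x ∷ v ∸ suc z ∷ suc x + suc z ∷ suc z ∷ []
  evaluate
    rewrite ≡ᵇ-refl x | ≡ᵇ-refl (x + suc z)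
          | ≢⇒≡ᵇ≡false (<⇒≢ x<x+1+z) | ≢⇒≡ᵇ≡false (<⇒≢ x<x+1+z ∘ sym)
          | ≥⇒<ᵇ≡false {x + suc z} {suc x} x<x+1+z | <⇒<ᵇ≡true {x} {suc (x + suc z)} (s≤s (m≤m+n x (suc z)))
          | +-identityʳ v | m+n∸m≡n x (suc z) | +-comm v (suc x) | [m+n]∸[m+o]≡n∸o (suc x) v (suc z)
    = refl

SumTriplePartition : ℕ → List (ℕ × ℕ) → Set
SumTriplePartition N ts = sumTriples ts ↭ range 1 N

SumTriplesWithin : ℕ → List (ℕ × ℕ) → Set
SumTriplesWithin N = All (All (λ i → 0 < i × i ≤ N) ∘ sumTriple)

partition-within : ∀ {N ts} → SumTriplePartition N ts → SumTriplesWithin N ts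
partition-within {N} partition =
  All.map⁻ (All.concat⁻ (All-resp-↭ (↭-sym partition) (All-range 1 N (λ 1≤i i<1+N → 1≤i , ≤-pred i<1+N))))

allPositiveDifferences-baseBlocks : ∀ {N ts} → SumTriplesWithin N ts →
  allPositiveDifferences (map baseBlock ts) ≡ sumTriples ts
allPositiveDifferences-baseBlocks []                                         = refl
allPositiveDifferences-baseBlocks (((0<x , _) ∷ _ ∷ (0<z , _) ∷ []) ∷ within) =
  cong₂ _++_ (positiveDifferences-baseBlock 0<x 0<z) (allPositiveDifferences-baseBlocks within)

allDifferences-baseBlocks : ∀ v {N ts} → SumTriplesWithin N ts →
  allDifferences v (map baseBlock ts) ↭ sumTriples ts ++ map (v ∸_) (sumTriples ts)
allDifferences-baseBlocks v []                                                        = ↭-refl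
allDifferences-baseBlocks v {ts = t ∷ ts} (((0<x , _) ∷ _ ∷ (0<z , _) ∷ []) ∷ within) = begin
  differences v (baseBlock t) ++ allDifferences v (map baseBlock ts)
    ↭⟨ ++⁺ (differences-baseBlock v 0<x 0<z) (allDifferences-baseBlocks v within) ⟩
  (T ++ map (v ∸_) T) ++ (S ++ map (v ∸_) S)
    ↭⟨ ↭-Solver.solve 4 (λ t t̄ s s̄ → (t ⊕ t̄) ⊕ (s ⊕ s̄) ⊜ (t ⊕ s) ⊕ (t̄ ⊕ s̄)) ↭-refl
         T (map (v ∸_) T) S (map (v ∸_) S) ⟩
  (T ++ S) ++ (map (v ∸_) T ++ map (v ∸_) S)
    ≡⟨ cong ((T ++ S) ++_) (map-++ (v ∸_) T S) ⟨
  (T ++ S) ++ map (v ∸_) (T ++ S)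
    ∎
  where
  open PermutationReasoning
  T S : List ℕ
  T = sumTriple t
  S = sumTriples ts

partition⇒PDF : ∀ {N ts} → SumTriplePartition N ts → IsPDF (suc (N + N)) 3 1 (map baseBlock ts)
partition⇒PDF {N} {ts} partition = (kSubsets , cdf) , pdf
  where
  v : ℕ
  v = suc (N + N)

  within : SumTriplesWithin N ts
  within = partition-within partition

  kSubsets : All (IsKSubset v 3) (map baseBlock ts)
  kSubsets = All.map⁺ (All.map (λ { ((0<x , _) ∷ (_ , x+z≤N) ∷ (0<z , _) ∷ []) →
    baseBlock-isKSubset 0<x 0<z (s≤s (≤-trans x+z≤N (m≤m+n N N))) }) within)

  differences↭ : allDifferences v (map baseBlock ts) ↭ range 1 (N + N)
  differences↭ = begin
    allDifferences v (map baseBlock ts)           ↭⟨ allDifferences-baseBlocks v within ⟩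
    sumTriples ts ++ map (v ∸_) (sumTriples ts)   ↭⟨ ++⁺ partition (map⁺ (v ∸_) partition) ⟩
    range 1 N ++ map (v ∸_) (range 1 N)           ↭⟨ ++⁺ˡ (range 1 N) (map-∸-range 1 N refl) ⟩
    range 1 N ++ range (suc N) N                  ≡⟨ range-++ 1 N N ⟨
    range 1 (N + N)                               ∎
    where open PermutationReasoning

  cdf : ∀ d → 1 ≤ d → d < v → mult d (allDifferences v (map baseBlock ts)) ≡ 1
  cdf d 1≤d d<v = trans (mult-↭ d differences↭) (mult-range-≡1 (N + N) 1≤d d<v)

  [v∸1]/2≡N : (v ∸ 1) / 2 ≡ N
  [v∸1]/2≡N = trans (cong (_/ 2) (trans (cong (N +_) (sym (+-identityʳ N))) (*-comm 2 N))) (m*n/n≡m N 2)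

  pdf : ∀ d → 1 ≤ d → d ≤ (v ∸ 1) / 2 → mult d (allPositiveDifferences (map baseBlock ts)) ≡ 1
  pdf d 1≤d d≤[v∸1]/2 = begin
    mult d (allPositiveDifferences (map baseBlock ts))  ≡⟨ cong (mult d) (allPositiveDifferences-baseBlocks within) ⟩
    mult d (sumTriples ts)                              ≡⟨ mult-↭ d partition ⟩
    mult d (range 1 N)                                  ≡⟨ mult-range-≡1 N 1≤d (s≤s (subst (d ≤_) [v∸1]/2≡N d≤[v∸1]/2)) ⟩
    1                                                   ∎
    where open ≡-Reasoning

-- The x's are p, p + 2, …, the z's run down from a + n - 1 to a, so the sums x + z are consecutive.
block : ℕ → ℕ → ℕ → List (ℕ × ℕ)
block p a zero    = []
block p a (suc n) = (p , n + a) ∷ block (2 + p) a n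

block-↭ : ∀ p a n s → p + a + n ≡ suc s →
  sumTriples (block p a n) ↭ progression 2 p n ++ range s n ++ range a n
block-↭ p a zero    s _  = ↭-refl
block-↭ p a (suc n) s eq = ↭-prep p (begin
  p + (n + a) ∷ n + a ∷ sumTriples (block (2 + p) a n)
    ≡⟨ cong (λ t → t ∷ n + a ∷ sumTriples (block (2 + p) a n)) first-sum≡s ⟩
  s ∷ n + a ∷ sumTriples (block (2 + p) a n)
    ↭⟨ ↭-prep s (↭-prep (n + a) (block-↭ (2 + p) a n (suc s) (cong suc (trans (sym (+-suc (p + a) n)) eq)))) ⟩
  s ∷ n + a ∷ (X ++ S ++ Z)
    ↭⟨ ↭-Solver.solve 5 (λ s z X S Z → s ⊕ z ⊕ X ⊕ S ⊕ Z ⊜ X ⊕ (s ⊕ S) ⊕ (Z ⊕ z)) ↭-refl [ s ] [ n + a ] X S Z ⟩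
  X ++ (s ∷ S) ++ (Z ∷ʳ (n + a))
    ≡⟨ cong (λ zs → X ++ (s ∷ S) ++ zs) (range-∷ʳ a n) ⟨
  X ++ range s (suc n) ++ range a (suc n)
    ∎)
  where
  open PermutationReasoning
  X S Z : List ℕ
  X = progression 2 (2 + p) n
  S = range (suc s) n
  Z = range a n

  first-sum≡s : p + (n + a) ≡ s
  first-sum≡s = suc-injective (trans (regroup p a n) eq)
    where
    regroup : ∀ p a n → suc (p + (n + a)) ≡ p + a + suc n
    regroup = solve-∀

block-++-↭ : ∀ p a n s {ts R} → p + a + n ≡ suc s → sumTriples ts ↭ R →
  sumTriples (block p a n ++ ts) ↭ (progression 2 p n ++ range s n ++ range a n) ++ R
block-++-↭ p a n s {ts} eq ts↭R =
  ↭-trans (↭-reflexive (concatMap-++ sumTriple (block p a n) ts)) (++⁺ (block-↭ p a n s eq) ts↭R)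

construction : ℕ → List (ℕ × ℕ)
construction u =
  block 2 (16 + 8 * u) (4 + 2 * u) ++ block (7 + 2 * u) (9 + 4 * u) u ++ block 3 (12 + 5 * u) u ++
  (5 + 2 * u , 9 + 5 * u) ∷ (1 , 10 + 5 * u) ∷ (3 + 2 * u , 12 + 6 * u) ∷ (7 + 4 * u , 13 + 6 * u) ∷ []

construction-partition : ∀ u → SumTriplePartition (12 * (2 + u)) (construction u)
construction-partition u = begin
  sumTriples (construction u)
    ↭⟨ block-++-↭ 2 (16 + 8 * u) (4 + 2 * u) (21 + 10 * u) (solve [ u ])
      (block-++-↭ (7 + 2 * u) (9 + 4 * u) u (15 + 7 * u) (solve [ u ])
      (block-++-↭ 3 (12 + 5 * u) u (14 + 6 * u) (solve [ u ])
      (++⁺ (block-↭ (5 + 2 * u) (9 + 5 * u) 1 (14 + 7 * u) (solve [ u ]))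
      (++⁺ (block-↭ 1 (10 + 5 * u) 1 (11 + 5 * u) (solve [ u ]))
      (++⁺ (block-↭ (3 + 2 * u) (12 + 6 * u) 1 (15 + 8 * u) (solve [ u ]))
           (block-↭ (7 + 4 * u) (13 + 6 * u) 1 (20 + 10 * u) (solve [ u ]))))))) ⟩
  _
    -- xB, sB, zB: the x's, sums and z's of a block B; xᵢ, sᵢ, zᵢ: those of the i-th single triple.
    -- The right-hand side lists the odd numbers below 9 + 4u, the even ones, and then [9 + 4u, 24 + 12u]
    -- in increasing order, each group closed by the [] that ends a list of runs.
    ↭⟨ ↭-Solver.solve 21
         (λ xA sA zA xB sB zB xC sC zC x₁ s₁ z₁ x₂ s₂ z₂ x₃ s₃ z₃ x₄ s₄ z₄ →
            (xA ⊕ sA ⊕ zA) ⊕ (xB ⊕ sB ⊕ zB) ⊕ (xC ⊕ sC ⊕ zC) ⊕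
            (x₁ ⊕ s₁ ⊕ z₁) ⊕ (x₂ ⊕ s₂ ⊕ z₂) ⊕ (x₃ ⊕ s₃ ⊕ z₃) ⊕ (x₄ ⊕ s₄ ⊕ z₄)
          ⊜ ((x₂ ⊕ xC ⊕ x₃ ⊕ x₁ ⊕ xB ⊕ x₄ ⊕ id) ⊕ xA) ⊕
            (zB ⊕ z₁ ⊕ z₂ ⊕ s₂ ⊕ zC ⊕ z₃ ⊕ z₄ ⊕ sC ⊕ s₁ ⊕ sB ⊕ s₃ ⊕ zA ⊕ s₄ ⊕ sA ⊕ id))
         ↭-refl
         (progression 2 2 (4 + 2 * u)) (range (21 + 10 * u) (4 + 2 * u)) (range (16 + 8 * u) (4 + 2 * u))
         (progression 2 (7 + 2 * u) u) (range (15 + 7 * u) u) (range (9 + 4 * u) u)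
         (progression 2 3 u) (range (14 + 6 * u) u) (range (12 + 5 * u) u)
         [ 5 + 2 * u ] [ 14 + 7 * u ] [ 9 + 5 * u ] [ 1 ] [ 11 + 5 * u ] [ 10 + 5 * u ]
         [ 3 + 2 * u ] [ 15 + 8 * u ] [ 12 + 6 * u ] [ 7 + 4 * u ] [ 20 + 10 * u ] [ 13 + 6 * u ] ⟩
  (runs 2 oddRuns ++ progression 2 2 (4 + 2 * u)) ++ runs 1 upperRuns
    ≡⟨ cong (λ os → (os ++ progression 2 2 (4 + 2 * u)) ++ runs 1 upperRuns)
            (runs-tile (4 + 2 * u) oddRuns oddConsecutive) ⟩
  (progression 2 1 (4 + 2 * u) ++ progression 2 2 (4 + 2 * u)) ++ runs 1 upperRuns
    ↭⟨ ++⁺ʳ (runs 1 upperRuns) (range-↭-interleaved 1 (4 + 2 * u)) ⟨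
  range 1 ((4 + 2 * u) + (4 + 2 * u)) ++ runs 1 upperRuns
    ≡⟨ runs-tile (12 * (2 + u)) ((1 , (4 + 2 * u) + (4 + 2 * u)) ∷ upperRuns) allConsecutive ⟩
  range 1 (12 * (2 + u))
    ∎
  where
  open PermutationReasoning
  oddRuns upperRuns : List (ℕ × ℕ)
  oddRuns = (1 , 1) ∷ (3 , u) ∷ (3 + 2 * u , 1) ∷ (5 + 2 * u , 1) ∷ (7 + 2 * u , u) ∷ (7 + 4 * u , 1) ∷ []
  upperRuns =
    (9 + 4 * u , u) ∷ (9 + 5 * u , 1) ∷ (10 + 5 * u , 1) ∷ (11 + 5 * u , 1) ∷ (12 + 5 * u , u) ∷
    (12 + 6 * u , 1) ∷ (13 + 6 * u , 1) ∷ (14 + 6 * u , u) ∷ (14 + 7 * u , 1) ∷ (15 + 7 * u , u) ∷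
    (15 + 8 * u , 1) ∷ (16 + 8 * u , 4 + 2 * u) ∷ (20 + 10 * u , 1) ∷ (21 + 10 * u , 4 + 2 * u) ∷ []

  oddConsecutive : Consecutive 2 1 oddRuns ((4 + 2 * u) * 2 + 1)
  oddConsecutive = refl , refl , solve [ u ] , refl , refl , solve [ u ] , solve [ u ]

  allConsecutive : Consecutive 1 1 ((1 , (4 + 2 * u) + (4 + 2 * u)) ∷ upperRuns) (12 * (2 + u) * 1 + 1)
  allConsecutive =
    refl , solve [ u ] ,
    solve [ u ] , refl , refl , refl , solve [ u ] ,
    refl , refl , solve [ u ] , refl , solve [ u ] ,
    refl , solve [ u ] , refl , solve [ u ]

partition-exists : ∀ q → Σ (List (ℕ × ℕ)) (SumTriplePartition (12 * q))
partition-exists 0             = [] , ↭-refl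
partition-exists 1             = pairs , ↭-sym (sort-↭ (sumTriples pairs))
  where
  -- sort (sumTriples pairs) evaluates to range 1 12.
  pairs : List (ℕ × ℕ)
  pairs = (1 , 5) ∷ (2 , 8) ∷ (3 , 9) ∷ (4 , 7) ∷ []
partition-exists (suc (suc u)) = construction u , construction-partition u

proposition2p1 : (v : ℕ) → 0 < v → v % 24 ≡ 1 →
                   Σ (List (List ℕ)) (λ 𝓕 → IsPDF v 3 1 𝓕)
proposition2p1 v _ v%24≡1 =
  subst (λ w → Σ (List (List ℕ)) (λ 𝓕 → IsPDF w 3 1 𝓕)) (sym v≡1+24q)
    (Product.map (map baseBlock) partition⇒PDF (partition-exists q))
  where
  q : ℕ
  q = v / 24

  v≡1+24q : v ≡ suc (12 * q + 12 * q)
  v≡1+24q = begin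
    v                       ≡⟨ m≡m%n+[m/n]*n v 24 ⟩
    v % 24 + q * 24         ≡⟨ cong (_+ q * 24) v%24≡1 ⟩
    1 + q * 24              ≡⟨ regroup q ⟩
    suc (12 * q + 12 * q)   ∎
    where
    open ≡-Reasoning
    regroup : ∀ q → 1 + q * 24 ≡ suc (12 * q + 12 * q)
    regroup = solve-∀
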